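{- In the model $M(A,\mathscr F,\mathscr G)$, the set $A$ of atoms is not H-infinite.
   Context: Start from a model with a set of atoms $A$ of size continuum and a bijection $\omega^\omega\to A$, $f\mapsto a_f$. Equip $\omega^\omega$ with the metric $d(f,g)=0$ if $f=g$ and $d(f,g)=1/(1+\Delta(f,g))$ otherwise, where $\Delta(f,g)=\min\{k: f(k)\neq g(k)\}$; for $s\in\omega^{<\omega}$ let $U_s=\{f\in\omega^\omega: f\upharpoonright|s|=s\}$. Let $\mathscr G$ be the group of permutations $\pi_\varphi$ of $A$ given by $\pi_\varphi(a_f)=a_{\varphi(f)}$ for isometries $\varphi$ of $\omega^\omega$. For $n<\omega$ and finite $F\subseteq\omega^\omega$ let $G_{n,F}=\{\pi_\varphi: \varphi(f)=f\text{ for all }f\in F,\ \varphi[U_s]=U_s\text{ for all }s\in\omega^n\}$. Let $\mathscr F$ be the normal filter of subgroups of $\mathscr G$ generated by the $G_{n,F}$, and $M(A,\mathscr F,\mathscr G)$ the resulting Fraenkel–Mostowski permutation model (class of hereditarily symmetric sets), a model of $\mathsf{ZFA}$. A set $X$ is H-finite if there is $c:[X]^{<\omega}\to 2$ such that for no infinite pairwise disjoint $Y\subseteq[X]^{<\omega}$ is $\mathrm{FU}(Y)=\{\bigcup_{y\in F}y: F\subseteq Y\text{ finite nonempty}\}$ $c$-monochromatic; H-infinite means not H-finite. -}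

module Defs where

open import Data.Nat using (ℕ; _<_)
open import Data.Fin using (Fin; toℕ)
open import Data.List using (List; []; map; concat)
open import Data.List.Relation.Unary.Any using (Any)
open import Data.List.Relation.Unary.All using (All)
open import Data.Product using (Σ; _×_)
open import Data.Sum using (_⊎_)
open import Relation.Nullary using (¬_)
open import Data.Empty using (⊥)
open import Relation.Binary.PropositionalEquality using (_≡_; _≢_)
open import Function.Bundles using (_⇔_)

-- Baire space ω^ω.  Atoms a_f are identified with points f (via the bijection f ↦ a_f).
Baire : Set
Baire = ℕ → ℕ

-- Equality of points of ω^ω (extensional; no funext available).
_≈_ : Baire → Baire → Set
f ≈ g = ∀ k → f k ≡ g k

AgreeBelow : ℕ → Baire → Baire → Set
AgreeBelow k f g = ∀ i → i < k → f i ≡ g i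

IsΔ : Baire → Baire → ℕ → Set
IsΔ f g k = AgreeBelow k f g × f k ≢ g k

-- d(f,g) = 0 if f = g, and 1/(1+Δ(f,g)) otherwise.  Since k ↦ 1/(1+k) is injective
-- and never 0, d(f,g) = d(f',g') holds exactly when the following holds.
SameDistance : Baire → Baire → Baire → Baire → Set
SameDistance f g f' g' = (f ≈ g ⇔ f' ≈ g') × (∀ k → IsΔ f g k ⇔ IsΔ f' g' k)

-- φ is an isometry of ω^ω onto itself (so π_φ is a permutation of A).
IsIsometry : (Baire → Baire) → Set
IsIsometry φ = (∀ f g → SameDistance f g (φ f) (φ g)) × (∀ g → Σ Baire λ f → φ f ≈ g)

InU : {n : ℕ} → (Fin n → ℕ) → Baire → Set
InU s f = ∀ i → f (toℕ i) ≡ s i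

ImageU≡U : {n : ℕ} → (Baire → Baire) → (Fin n → ℕ) → Set
ImageU≡U φ s = (∀ f → InU s f → InU s (φ f))
             × (∀ g → InU s g → Σ Baire λ f → InU s f × φ f ≈ g)

_∈A_ : Baire → List Baire → Set
f ∈A x = Any (f ≈_) x

InG : ℕ → List Baire → (Baire → Baire) → Set
InG n F φ = IsIsometry φ
          × (∀ f → f ∈A F → φ f ≈ f)
          × (∀ (s : Fin n → ℕ) → ImageU≡U φ s)

-- Finite subsets of A are lists of points; equality of finite sets.
_≐_ : List Baire → List Baire → Set
x ≐ y = ∀ f → (f ∈A x) ⇔ (f ∈A y)

-- A subset of [A]^{<ω}, resp. a 2-colouring of [A]^{<ω} (colour 0 = in C, colour 1 = not in C),
-- given as a predicate that must respect equality of finite sets.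
RespectsSetEq : (List Baire → Set) → Set
RespectsSetEq P = ∀ x y → x ≐ y → P x → P y

-- Symmetric (w.r.t. the normal filter generated by the G_{n,F}): fixed by all of some G_{n,F}.
-- For a set of finite sets of atoms (or a colouring of them) this is the same as being
-- hereditarily symmetric, i.e. belonging to M(A,𝓕,𝓖).
Symmetric : (List Baire → Set) → Set
Symmetric P = Σ ℕ λ n → Σ (List Baire) λ F →
  ∀ φ → InG n F φ → ∀ x → P x ⇔ P (map φ x)

Infinite : (List Baire → Set) → Set
Infinite Y = ¬ (Σ (List (List Baire)) λ L → ∀ x → Y x → Any (x ≐_) L)

PairwiseDisjoint : (List Baire → Set) → Set
PairwiseDisjoint Y = ∀ x y → Y x → Y y → ¬ (x ≐ y) → ∀ f → f ∈A x → f ∈A y → ⊥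

FU : (List Baire → Set) → List Baire → Set
FU Y x = Σ (List (List Baire)) λ ys → ys ≢ [] × All Y ys × x ≐ concat ys

Monochromatic : (List Baire → Set) → (List Baire → Set) → Set
Monochromatic C S = (∀ x → S x → C x) ⊎ (∀ x → S x → ¬ C x)

HFiniteA : Set₁
HFiniteA = Σ (List Baire → Set) λ C → RespectsSetEq C × Symmetric C ×
  (∀ (Y : List Baire → Set) → RespectsSetEq Y → Symmetric Y →
     Infinite Y → PairwiseDisjoint Y → ¬ Monochromatic C (FU Y))

HInfiniteA : Set₁
HInfiniteA = ¬ HFiniteA

-- The colouring is "is a singleton", which every isometry preserves.  If FU(Y) consists of
-- singletons, any two members of Y are singletons whose union is again a singleton, so they are
-- equal and Y is finite.  If FU(Y) contains no singletons, let G_{n,F} fix Y and let y ∈ Y contain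
-- a point g ∉ F and a second point h.  For m ≥ n beyond the depth at which g is separated from the
-- other points of F and of y, the isometry flipping the parity of coordinate m on the ball U_{g↾m}
-- lies in G_{n,F}, fixes h and moves g out of y; so it maps y to a different member of Y that still
-- contains h, contradicting disjointness.  Hence all members of Y lie inside F, and being pairwise
-- disjoint there are only finitely many of them.
--
-- Equality of points is undecidable, but every case distinction happens inside a proof of ⊥ and is
-- made in the double-negation monad; finitely many points are separated at a finite depth, which
-- makes equality among them decidable where a finite cover of Y has to be exhibited.
module Submission where

open import Defs
open import Level using (0ℓ)
open import Data.Nat using (ℕ; zero; suc; _≤_; _≟_; _⊔_)
open import Data.Nat.Properties
  using (<-≤-trans; <⇒≢; n<1+n; n≤1+n; m<1+n⇒m<n∨m≡n; m≤m⊔n; m≤n⊔m; suc-injective)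
open import Data.Fin using (Fin)
open import Data.Fin.Properties using (toℕ<n)
open import Data.List using (List; []; _∷_; _++_; map)
open import Data.List.Properties using (++-identityʳ)
open import Data.List.Membership.Propositional using (_∈_; find; lose)
open import Data.List.Relation.Unary.Any as Any using (Any; here; there)
open import Data.List.Relation.Unary.Any.Properties using (map⁺; map⁻; ++⁺ˡ; ++⁺ʳ)
open import Data.List.Relation.Unary.All as All using (All; []; _∷_)
open import Data.List.Relation.Unary.All.Properties using (++⁻ˡ; ++⁻ʳ)
open import Data.Product using (Σ; _×_; _,_; proj₁; proj₂; uncurry)
open import Data.Sum using (_⊎_; inj₁; inj₂)
import Data.Sum as Sum
open import Data.Empty using (⊥; ⊥-elim)
open import Effect.Monad using (RawMonad)
open import Function using (_∘_)
open import Function.Bundles using (_⇔_; mk⇔; Equivalence)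
open import Relation.Nullary using (¬_; Dec; yes; no)
open import Relation.Nullary.Decidable
  using (decidable-stable; ¬¬-excluded-middle; map′; _×-dec_; _⊎-dec_)
open import Relation.Nullary.Negation using (¬¬-Monad; Stable)
open import Relation.Binary.PropositionalEquality
  using (_≡_; _≢_; refl; sym; trans; cong; module ≡-Reasoning)
open ≡-Reasoning

open Equivalence using (to; from)
open RawMonad (¬¬-Monad {a = 0ℓ}) using (_>>=_; return)

private
  variable
    A B : Set
    f f′ g g′ h a : Baire
    k m n : ℕ
    x y L : List Baire

≈-refl : f ≈ f
≈-refl _ = refl

≈-sym : f ≈ g → g ≈ f
≈-sym f≈g k = sym (f≈g k)

≈-trans : f ≈ g → g ≈ h → f ≈ h
≈-trans f≈g g≈h k = trans (f≈g k) (g≈h k)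

≈-stable : Stable (f ≈ g)
≈-stable {f} {g} ¬¬f≈g k = decidable-stable (f k ≟ g k) (λ ne → ¬¬f≈g (λ f≈g → ne (f≈g k)))

¬≈⇒¬¬-differ : ¬ f ≈ g → ¬ ¬ Σ ℕ λ k → f k ≢ g k
¬≈⇒¬¬-differ {f} {g} f≉g none = f≉g (λ k → decidable-stable (f k ≟ g k) (λ ne → none (k , ne)))

≈⇒agreeBelow : f ≈ g → AgreeBelow m f g
≈⇒agreeBelow f≈g i _ = f≈g i

agreeBelow-sym : AgreeBelow m f g → AgreeBelow m g f
agreeBelow-sym agree i i<m = sym (agree i i<m)

agreeBelow-trans : AgreeBelow m f g → AgreeBelow m g h → AgreeBelow m f h
agreeBelow-trans agree agree′ i i<m = trans (agree i i<m) (agree′ i i<m)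

agreeBelow-resp : f ≈ f′ → g ≈ g′ → AgreeBelow m f g → AgreeBelow m f′ g′
agreeBelow-resp f≈f′ g≈g′ agree =
  agreeBelow-trans (≈⇒agreeBelow (≈-sym f≈f′)) (agreeBelow-trans agree (≈⇒agreeBelow g≈g′))

agreeBelow-mono : m ≤ n → AgreeBelow n f g → AgreeBelow m f g
agreeBelow-mono m≤n agree i i<m = agree i (<-≤-trans i<m m≤n)

agreeBelow-suc : AgreeBelow m f g → f m ≡ g m → AgreeBelow (suc m) f g
agreeBelow-suc agree eq i i<1+m with m<1+n⇒m<n∨m≡n i<1+m
... | inj₁ i<m  = agree i i<m
... | inj₂ refl = eq

agreeBelow? : ∀ m f g → Dec (AgreeBelow m f g)
agreeBelow? zero    f g = yes (λ _ ())
agreeBelow? (suc m) f g =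
  map′ (uncurry agreeBelow-suc) (λ agree → agreeBelow-mono (n≤1+n m) agree , agree m (n<1+n m))
       (agreeBelow? m f g ×-dec (f m ≟ g m))

module _ (preserve : ∀ {m} → AgreeBelow m f g → AgreeBelow m f′ g′) where

  ≈-transport : f ≈ g → f′ ≈ g′
  ≈-transport f≈g k = preserve (≈⇒agreeBelow {m = suc k} f≈g) k (n<1+n k)

  isΔ-transport : (∀ {m} → AgreeBelow m f′ g′ → AgreeBelow m f g) → IsΔ f g k → IsΔ f′ g′ k
  isΔ-transport {k} reflect (agree , differ) =
    preserve agree , λ eq → differ (reflect (agreeBelow-suc (preserve agree) eq) k (n<1+n k))

sameDistance-fromAgreeBelow : (∀ {m} → AgreeBelow m f g → AgreeBelow m f′ g′) →
                              (∀ {m} → AgreeBelow m f′ g′ → AgreeBelow m f g) →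
                              SameDistance f g f′ g′
sameDistance-fromAgreeBelow preserve reflect =
  mk⇔ (≈-transport preserve) (≈-transport reflect) ,
  λ k → mk⇔ (isΔ-transport preserve reflect) (isΔ-transport reflect preserve)

flipParity : ℕ → ℕ
flipParity zero          = 1
flipParity (suc zero)    = 0
flipParity (suc (suc k)) = suc (suc (flipParity k))

flipParity-involutive : ∀ k → flipParity (flipParity k) ≡ k
flipParity-involutive zero          = refl
flipParity-involutive (suc zero)    = refl
flipParity-involutive (suc (suc k)) = cong (suc ∘ suc) (flipParity-involutive k)

flipParity-≢ : ∀ k → flipParity k ≢ k
flipParity-≢ (suc (suc k)) eq = flipParity-≢ k (suc-injective (suc-injective eq))

module Swap (c : Baire) (m : ℕ) where

  swap : Baire → Baire
  swap f i with i ≟ m | agreeBelow? m f c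
  ... | yes _ | yes _ = flipParity (f i)
  ... | _     | _     = f i

  swap-away : ∀ {i} → i ≢ m → swap f i ≡ f i
  swap-away {f} {i} i≢m with i ≟ m | agreeBelow? m f c
  ... | yes i≡m | _ = ⊥-elim (i≢m i≡m)
  ... | no _    | _ = refl

  swap-outside : ¬ AgreeBelow m f c → swap f ≈ f
  swap-outside {f} f≁c i with i ≟ m | agreeBelow? m f c
  ... | yes _ | yes f∼c = ⊥-elim (f≁c f∼c)
  ... | yes _ | no _    = refl
  ... | no _  | _       = refl

  swap-inside : AgreeBelow m f c → swap f m ≡ flipParity (f m)
  swap-inside {f} f∼c with m ≟ m | agreeBelow? m f c
  ... | yes _   | yes _   = refl
  ... | yes _   | no f≁c  = ⊥-elim (f≁c f∼c)
  ... | no m≢m  | _       = ⊥-elim (m≢m refl)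

  swap-agreeBelow : AgreeBelow m (swap f) f
  swap-agreeBelow i i<m = swap-away (<⇒≢ i<m)

  swap-moves-centre : swap c m ≢ c m
  swap-moves-centre eq = flipParity-≢ (c m) (trans (sym (swap-inside (≈⇒agreeBelow ≈-refl))) eq)

  swap-cong-at : AgreeBelow (suc m) f g → swap f m ≡ swap g m
  swap-cong-at {f} {g} agree = by-cases (agreeBelow? m f c)
    where
    below : AgreeBelow m f g
    below = agreeBelow-mono (n≤1+n m) agree

    by-cases : Dec (AgreeBelow m f c) → swap f m ≡ swap g m
    by-cases (yes f∼c) = begin
      swap f m          ≡⟨ swap-inside f∼c ⟩
      flipParity (f m)  ≡⟨ cong flipParity (agree m (n<1+n m)) ⟩
      flipParity (g m)  ≡⟨ swap-inside (agreeBelow-trans (agreeBelow-sym below) f∼c) ⟨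
      swap g m          ∎
    by-cases (no f≁c) = begin
      swap f m  ≡⟨ swap-outside f≁c m ⟩
      f m       ≡⟨ agree m (n<1+n m) ⟩
      g m       ≡⟨ swap-outside (f≁c ∘ agreeBelow-trans below) m ⟨
      swap g m  ∎

  swap-preserves-agreeBelow : AgreeBelow n f g → AgreeBelow n (swap f) (swap g)
  swap-preserves-agreeBelow {n} {f} {g} agree i i<n = by-cases (i ≟ m)
    where
    by-cases : Dec (i ≡ m) → swap f i ≡ swap g i
    by-cases (yes i≡m) rewrite i≡m = swap-cong-at (agreeBelow-mono i<n agree)
    by-cases (no i≢m)  = trans (swap-away i≢m) (trans (agree i i<n) (sym (swap-away i≢m)))

  swap-cong : f ≈ g → swap f ≈ swap g
  swap-cong = ≈-transport swap-preserves-agreeBelow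

  swap-involutive : ∀ f → swap (swap f) ≈ f
  swap-involutive f i = by-cases (agreeBelow? m f c) (i ≟ m)
    where
    by-cases : Dec (AgreeBelow m f c) → Dec (i ≡ m) → swap (swap f) i ≡ f i
    by-cases (no f≁c) _ =
      trans (swap-outside (f≁c ∘ agreeBelow-trans (agreeBelow-sym swap-agreeBelow)) i)
            (swap-outside f≁c i)
    by-cases (yes f∼c) (yes i≡m) rewrite i≡m = begin
      swap (swap f) m               ≡⟨ swap-inside (agreeBelow-trans swap-agreeBelow f∼c) ⟩
      flipParity (swap f m)         ≡⟨ cong flipParity (swap-inside f∼c) ⟩
      flipParity (flipParity (f m)) ≡⟨ flipParity-involutive (f m) ⟩
      f m                           ∎
    by-cases (yes _) (no i≢m) = trans (swap-away i≢m) (swap-away i≢m)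

  swap-isometry : IsIsometry swap
  swap-isometry = (λ f g → sameDistance-fromAgreeBelow swap-preserves-agreeBelow (reflect f g)) ,
                  λ g → swap g , swap-involutive g
    where
    reflect : ∀ f g → AgreeBelow n (swap f) (swap g) → AgreeBelow n f g
    reflect f g = agreeBelow-resp (swap-involutive f) (swap-involutive g) ∘ swap-preserves-agreeBelow

  swap-∈U : n ≤ m → (s : Fin n → ℕ) → InU s f → InU s (swap f)
  swap-∈U n≤m s f∈U i = trans (swap-away (<⇒≢ (<-≤-trans (toℕ<n i) n≤m))) (f∈U i)

  swap-∈G : ∀ {F} → n ≤ m → (∀ f → f ∈A F → swap f ≈ f) → InG n F swap
  swap-∈G n≤m fixes = swap-isometry , fixes ,
    λ s → (λ f → swap-∈U n≤m s) , λ g g∈U → swap g , swap-∈U n≤m s g∈U , swap-involutive g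

∈A-resp : f ≈ g → f ∈A x → g ∈A x
∈A-resp f≈g = Any.map (≈-trans (≈-sym f≈g))

∈A-singleton⁻ : f ∈A (a ∷ []) → f ≈ a
∈A-singleton⁻ (here f≈a) = f≈a

∈A-map⁺ : ∀ {φ} → (∀ {f g} → f ≈ g → φ f ≈ φ g) → f ∈A x → φ f ∈A map φ x
∈A-map⁺ φ-cong = map⁺ ∘ Any.map φ-cong

≐-refl : x ≐ x
≐-refl _ = mk⇔ (λ p → p) (λ p → p)

≐-sym : x ≐ y → y ≐ x
≐-sym x≐y f = mk⇔ (from (x≐y f)) (to (x≐y f))

≐-trans : ∀ {z} → x ≐ y → y ≐ z → x ≐ z
≐-trans x≐y y≐z f = mk⇔ (to (y≐z f) ∘ to (x≐y f)) (from (x≐y f) ∘ from (y≐z f))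

≡⇒≐ : x ≡ y → x ≐ y
≡⇒≐ refl = ≐-refl

IsSingleton : List Baire → Set
IsSingleton x = Σ Baire λ a → x ≐ (a ∷ [])

isSingleton-resp : RespectsSetEq IsSingleton
isSingleton-resp x y x≐y (a , x≐[a]) = a , ≐-trans (≐-sym x≐y) x≐[a]

≈⇒singleton-≐ : f ≈ g → (f ∷ []) ≐ (g ∷ [])
≈⇒singleton-≐ f≈g h = mk⇔ (λ h∈[f] → here (≈-trans (∈A-singleton⁻ h∈[f]) f≈g))
                          (λ h∈[g] → here (≈-trans (∈A-singleton⁻ h∈[g]) (≈-sym f≈g)))

singleton-++⇒≐ : IsSingleton x → IsSingleton y → IsSingleton (x ++ y) → x ≐ y
singleton-++⇒≐ {x} (a , x≐[a]) (b , y≐[b]) (c , xy≐[c]) =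
  ≐-trans x≐[a] (≐-trans (≈⇒singleton-≐ (≈-trans a≈c (≈-sym b≈c))) (≐-sym y≐[b]))
  where
  a≈c : a ≈ c
  a≈c = ∈A-singleton⁻ (to (xy≐[c] a) (++⁺ˡ (from (x≐[a] a) (here ≈-refl))))
  b≈c : b ≈ c
  b≈c = ∈A-singleton⁻ (to (xy≐[c] b) (++⁺ʳ x (from (y≐[b] b) (here ≈-refl))))

module _ {φ : Baire → Baire} (iso : IsIsometry φ) where

  private
    φ-cong : f ≈ g → φ f ≈ φ g
    φ-cong {f} {g} = to (proj₁ (proj₁ iso f g))

    φ-injective : φ f ≈ φ g → f ≈ g
    φ-injective {f} {g} = from (proj₁ (proj₁ iso f g))

  isometry-preserves-singletons : IsSingleton x ⇔ IsSingleton (map φ x)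
  isometry-preserves-singletons {x} = mk⇔ image preimage
    where
    image : IsSingleton x → IsSingleton (map φ x)
    image (a , x≐[a]) = φ a , λ f → mk⇔
      (λ f∈φx → let w , w∈x , f≈φw = find (map⁻ f∈φx) in
        here (≈-trans f≈φw (φ-cong (∈A-singleton⁻ (to (x≐[a] w) (lose w∈x ≈-refl))))))
      (λ f∈[φa] → ∈A-resp (≈-sym (∈A-singleton⁻ f∈[φa]))
                          (∈A-map⁺ φ-cong (from (x≐[a] a) (here ≈-refl))))
    preimage : IsSingleton (map φ x) → IsSingleton x
    preimage (b , φx≐[b]) with proj₂ iso b
    ... | a , φa≈b = a , λ f → mk⇔
      (λ f∈x → here (φ-injective (≈-trans (∈A-singleton⁻ (to (φx≐[b] (φ f)) (∈A-map⁺ φ-cong f∈x)))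
                                          (≈-sym φa≈b))))
      (λ f∈[a] → let w , w∈x , φa≈φw = find (map⁻ (from (φx≐[b] (φ a)) (here φa≈b))) in
        lose w∈x (≈-trans (∈A-singleton⁻ f∈[a]) (φ-injective φa≈φw)))

isSingleton-symmetric : Symmetric IsSingleton
isSingleton-symmetric = 0 , [] , λ φ (iso , _) x → isometry-preserves-singletons iso

¬¬-all : {P : A → Set} (xs : List A) → (∀ a → ¬ ¬ P a) → ¬ ¬ All P xs
¬¬-all []       _ = return []
¬¬-all (a ∷ as) p = do
  pa  ← p a
  pas ← ¬¬-all as p
  return (pa ∷ pas)

Monotone : (ℕ → Set) → Set
Monotone P = ∀ {m n} → m ≤ n → P m → P n

commonBound : ∀ {P : A → ℕ → Set} {xs} → (∀ {a} → Monotone (P a)) →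
              All (λ a → Σ ℕ (P a)) xs → Σ ℕ λ m → All (λ a → P a m) xs
commonBound mono []               = 0 , []
commonBound mono ((m , pa) ∷ ps) with commonBound mono ps
... | n , pas = m ⊔ n , mono (m≤m⊔n m n) pa ∷ All.map (mono (m≤n⊔m m n)) pas

WitnessList : (A → B → Set) → List A → List B → Set
WitnessList {B = B} R xs L = ∀ {a} → a ∈ xs → Σ B (R a) → Any (R a) L

¬¬-witnessList : (R : A → B → Set) (xs : List A) → ¬ ¬ Σ (List B) (WitnessList R xs)
¬¬-witnessList R []       = return ([] , λ ())
¬¬-witnessList {B = B} R (a ∷ as) = do
  witnesses ← ¬¬-witnessList R as
  witnessed? ← ¬¬-excluded-middle
  return (extend witnesses witnessed?)
  where
  extend : Σ (List B) (WitnessList R as) → Dec (Σ B (R a)) → Σ (List B) (WitnessList R (a ∷ as))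
  extend (L , wit) (yes (b , r)) = b ∷ L , λ { (here refl) _ → here r ; (there a′∈) w → there (wit a′∈ w) }
  extend (L , wit) (no none)     = L ,     λ { (here refl) w → ⊥-elim (none w) ; (there a′∈) w → wit a′∈ w }

SeparatedFrom : ℕ → Baire → Baire → Set
SeparatedFrom m g w = w ≈ g ⊎ ¬ AgreeBelow m w g

separatedFrom-mono : ∀ {g w} → Monotone (λ m → SeparatedFrom m g w)
separatedFrom-mono m≤n = Sum.map₂ (λ w≁g → w≁g ∘ agreeBelow-mono m≤n)

¬¬-separatedFrom : ∀ g w → ¬ ¬ Σ ℕ λ m → SeparatedFrom m g w
¬¬-separatedFrom g w = ¬¬-excluded-middle >>= separate
  where
  separate : Dec (w ≈ g) → ¬ ¬ Σ ℕ λ m → SeparatedFrom m g w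
  separate (yes w≈g) = return (0 , inj₁ w≈g)
  separate (no w≉g)  = do
    k , differ ← ¬≈⇒¬¬-differ w≉g
    return (suc k , inj₂ λ agree → differ (agree k (n<1+n k)))

¬¬-separationDepth : ∀ g L → ¬ ¬ Σ ℕ λ m → All (SeparatedFrom m g) L
¬¬-separationDepth g L = do
  separations ← ¬¬-all L (¬¬-separatedFrom g)
  return (commonBound separatedFrom-mono separations)

Separating : ℕ → List Baire → Set
Separating m L = ∀ {a b} → a ∈A L → b ∈A L → AgreeBelow m a b → a ≈ b

¬¬-separating : ∀ L → ¬ ¬ Σ ℕ λ m → Separating m L
¬¬-separating L = do
  depths ← ¬¬-all L (λ a → ¬¬-separationDepth a L)
  let m , separations = commonBound (λ m≤n → All.map (separatedFrom-mono m≤n)) depths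
  return (m , λ {a b} → separating separations)
  where
  separating : All (λ a → All (SeparatedFrom m a) L) L → Separating m L
  separating separations a∈L b∈L agree with find a∈L | find b∈L
  ... | a′ , a′∈L , a≈a′ | b′ , b′∈L , b≈b′ with All.lookup (All.lookup separations a′∈L) b′∈L
  ...   | inj₁ b′≈a′ = ≈-trans a≈a′ (≈-trans (≈-sym b′≈a′) (≈-sym b≈b′))
  ...   | inj₂ b′≁a′ = ⊥-elim (b′≁a′ (agreeBelow-resp b≈b′ a≈a′ (agreeBelow-sym agree)))

_⊆A_ : List Baire → List Baire → Set
x ⊆A y = ∀ {f} → f ∈A x → f ∈A y

module _ (separating : Separating m L) where

  ≈-dec : f ∈A L → g ∈A L → Dec (f ≈ g)
  ≈-dec {f} {g} f∈L g∈L = map′ (separating f∈L g∈L) ≈⇒agreeBelow (agreeBelow? m f g)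

  ∈A-dec : f ∈A L → x ⊆A L → Dec (f ∈A x)
  ∈A-dec {x = []}    _   _   = no λ ()
  ∈A-dec {x = w ∷ x} f∈L x⊆L =
    map′ Any.fromSum Any.toSum (≈-dec f∈L (x⊆L (here ≈-refl)) ⊎-dec ∈A-dec f∈L (x⊆L ∘ there))

  ∈A-stable : Stable (f ∈A L)
  ∈A-stable {f} ¬¬f∈L with Any.any? (agreeBelow? m f) L
  ... | yes agreeing = let a , a∈L , f∼a = find agreeing in
    lose a∈L (≈-stable λ f≉a → ¬¬f∈L λ f∈L → f≉a (separating f∈L (lose a∈L ≈-refl) f∼a))
  ... | no none = ⊥-elim (¬¬f∈L λ f∈L → none (Any.map ≈⇒agreeBelow f∈L))

  ≐-stable : x ⊆A L → y ⊆A L → Stable (x ≐ y)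
  ≐-stable x⊆L y⊆L ¬¬x≐y f = mk⇔
    (λ f∈x → decidable-stable (∈A-dec (x⊆L f∈x) y⊆L) (λ f∉y → ¬¬x≐y λ x≐y → f∉y (to (x≐y f) f∈x)))
    (λ f∈y → decidable-stable (∈A-dec (y⊆L f∈y) x⊆L) (λ f∉x → ¬¬x≐y λ x≐y → f∉x (from (x≐y f) f∈y)))

module _ {Y : List Baire → Set} where

  fu-single : Y x → FU Y x
  fu-single {x} Yx = x ∷ [] , (λ ()) , Yx ∷ [] , ≡⇒≐ (sym (++-identityʳ x))

  fu-pair : Y x → Y y → FU Y (x ++ y)
  fu-pair {x} {y} Yx Yy =
    x ∷ y ∷ [] , (λ ()) , Yx ∷ Yy ∷ [] , ≡⇒≐ (cong (x ++_) (sym (++-identityʳ y)))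

  infinite⇒¬¬inhabited : Infinite Y → ¬ ¬ Σ (List Baire) Y
  infinite⇒¬¬inhabited infinite empty = infinite ([] , λ x Yx → ⊥-elim (empty (x , Yx)))

  FU-singletons⇒¬Infinite : (∀ x → FU Y x → IsSingleton x) → ¬ Infinite Y
  FU-singletons⇒¬Infinite singletons infinite = infinite⇒¬¬inhabited infinite λ (y , Yy) →
    infinite (y ∷ [] , λ x Yx →
      here (singleton-++⇒≐ (single Yx) (single Yy) (singletons _ (fu-pair Yx Yy))))
    where
    single : Y x → IsSingleton x
    single Yx = singletons _ (fu-single Yx)

  disjoint-within⇒¬Infinite : ∀ {F} → PairwiseDisjoint Y →
                              (∀ {y g} → Y y → g ∈A y → ¬ ¬ g ∈A F) → ¬ Infinite Y
  disjoint-within⇒¬Infinite {F} disjoint within infinite =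
    ¬¬-separating F λ (m , separating) →
    ¬¬-witnessList (λ a y → Y y × a ∈A y) F λ (L , witnesses) →
    infinite ([] ∷ L , cover separating witnesses)
    where
    ⊆F : Separating m F → Y y → y ⊆A F
    ⊆F separating Yy w∈y = ∈A-stable separating (within Yy w∈y)

    cover : ∀ {L} → Separating m F → WitnessList (λ a y → Y y × a ∈A y) F L →
            ∀ x → Y x → Any (x ≐_) ([] ∷ L)
    cover separating witnesses []      Yx = here ≐-refl
    cover separating witnesses (z ∷ x) Yx with find (⊆F separating Yx (here ≈-refl))
    ... | a , a∈F , z≈a = there (Any.map same (witnesses a∈F (z ∷ x , Yx , here (≈-sym z≈a))))
      where
      same : ∀ {y} → Y y × a ∈A y → (z ∷ x) ≐ y
      same (Yy , a∈y) = ≐-stable separating (⊆F separating Yx) (⊆F separating Yy)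
        λ x≉y → disjoint _ _ Yx Yy x≉y a (here (≈-sym z≈a)) a∈y

module _ {Y : List Baire → Set} {n : ℕ} {F : List Baire}
         (invariant : ∀ φ → InG n F φ → ∀ x → Y x ⇔ Y (map φ x))
         (disjoint : PairwiseDisjoint Y) where

  private
    module Swapped {y g M} (Yy : Y y) (g∉F : ¬ g ∈A F) (n≤M : n ≤ M)
                   (separations : All (SeparatedFrom M g) (F ++ y)) where

      open Swap g M public

      fixed : ∀ {L w} → All (SeparatedFrom M g) L → w ∈ L → ¬ w ≈ g → swap w ≈ w
      fixed separations w∈L w≉g with All.lookup separations w∈L
      ... | inj₁ w≈g = ⊥-elim (w≉g w≈g)
      ... | inj₂ w≁g = swap-outside w≁g

      fixes-F : ∀ f → f ∈A F → swap f ≈ f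
      fixes-F f f∈F = let w , w∈F , f≈w = find f∈F in
        ≈-trans (swap-cong f≈w)
                (≈-trans (fixed (++⁻ˡ F separations) w∈F (λ w≈g → g∉F (lose w∈F (≈-sym w≈g))))
                         (≈-sym f≈w))

      Y-swap-y : Y (map swap y)
      Y-swap-y = to (invariant swap (swap-∈G n≤M fixes-F) y) Yy

      ∈-swap-y : h ∈A y → ¬ h ≈ g → h ∈A map swap y
      ∈-swap-y h∈y h≉g = let w , w∈y , h≈w = find h∈y in
        map⁺ (lose w∈y (≈-trans h≈w (≈-sym (fixed (++⁻ʳ F separations) w∈y
                                                   (λ w≈g → h≉g (≈-trans h≈w w≈g))))))

      swap-g∉y : ¬ swap g ∈A y
      swap-g∉y swap-g∈y with find swap-g∈y
      ... | w , w∈y , swap-g≈w with All.lookup (++⁻ʳ F separations) w∈y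
      ...   | inj₁ w≈g = swap-moves-centre (trans (swap-g≈w M) (w≈g M))
      ...   | inj₂ w≁g = w≁g (agreeBelow-trans (agreeBelow-sym (≈⇒agreeBelow swap-g≈w)) swap-agreeBelow)

      y≉swap-y : g ∈A y → ¬ y ≐ map swap y
      y≉swap-y g∈y y≐swap-y = swap-g∉y (from (y≐swap-y (swap g)) (∈A-map⁺ swap-cong g∈y))

  outside-support⇒singleton : Y y → g ∈A y → ¬ g ∈A F → y ≐ (g ∷ [])
  outside-support⇒singleton {y} {g} Yy g∈y g∉F f = mk⇔
    (λ f∈y → here (≈-stable (no-second-point f∈y)))
    (λ f∈[g] → ∈A-resp (≈-sym (∈A-singleton⁻ f∈[g])) g∈y)
    where
    no-second-point : h ∈A y → ¬ ¬ h ≈ g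
    no-second-point {h} h∈y h≉g = ¬¬-separationDepth g (F ++ y) λ (m , separations) →
      let open Swapped Yy g∉F (m≤n⊔m m n) (All.map (separatedFrom-mono (m≤m⊔n m n)) separations)
      in disjoint y (map swap y) Yy Y-swap-y (y≉swap-y g∈y) h h∈y (∈-swap-y h∈y h≉g)

FU-nonSingletons⇒¬Infinite : ∀ {Y} → Symmetric Y → PairwiseDisjoint Y →
                             (∀ x → FU Y x → ¬ IsSingleton x) → ¬ Infinite Y
FU-nonSingletons⇒¬Infinite {Y} (n , F , invariant) disjoint nonSingletons infinite =
  ¬¬-excluded-middle by-cases
  where
  by-cases : Dec (Σ (List Baire) λ y → Σ Baire λ g → Y y × g ∈A y × ¬ g ∈A F) → ⊥
  by-cases (yes (y , g , Yy , g∈y , g∉F)) =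
    nonSingletons y (fu-single Yy) (g , outside-support⇒singleton invariant disjoint Yy g∈y g∉F)
  by-cases (no none) =
    disjoint-within⇒¬Infinite disjoint (λ Yy g∈y g∉F → none (_ , _ , Yy , g∈y , g∉F)) infinite

singletons-HFinite : HFiniteA
singletons-HFinite = IsSingleton , isSingleton-resp , isSingleton-symmetric ,
  λ { Y _ symmetric infinite disjoint (inj₁ singletons) → FU-singletons⇒¬Infinite singletons infinite
    ; Y _ symmetric infinite disjoint (inj₂ nonSingletons) →
        FU-nonSingletons⇒¬Infinite symmetric disjoint nonSingletons infinite }

lemma4p1 : ¬ HInfiniteA
lemma4p1 ¬hFinite = ¬hFinite singletons-HFinite
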